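{- Let $P$ be a finite ordered set (not necessarily $N$-free) having a minimal element $a$ such that $a$ is not maximal in $P$ and every upper cover of $a$ is minimal in $P\setminus\{a\}$. Let $x$ and $y$ be two incomparable elements of $P\setminus\{a\}$. Then the number of greedy linear extensions of $P$ that put $x$ before $y$ equals the number of greedy linear extensions of $P\setminus\{a\}$ that put $x$ before $y$.
   Context: $y$ is an upper cover of $x$ if $x<y$ and no $z$ satisfies $x<z<y$. $P\setminus\{a\}$ denotes the induced suborder on the remaining elements. For a finite ordered set $Q$, $U(x)=\{v: x<v\}$, and a linear extension $L=x_1<\cdots<x_n$ of $Q$ is greedy if: $x_1$ is minimal in $Q$; having chosen $x_1,\dots,x_i$, if no element of $U(x_i)$ is minimal in $Q\setminus\{x_1,\dots,x_i\}$ (in particular if $U(x_i)=\varnothing$), then $x_{i+1}$ is any minimal element of $Q\setminus\{x_1,\dots,x_i\}$; otherwise $x_{i+1}$ is an element of $U(x_i)$ minimal in $Q\setminus\{x_1,\dots,x_i\}$. -}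

module Defs where

open import Data.Nat using (ℕ)
open import Data.Fin using (Fin)
import Data.Fin as F
open import Data.List using (List; []; _∷_; _++_; [_]; length; lookup)
open import Data.List.Membership.Propositional using (_∈_; _∉_)
open import Data.List.Relation.Unary.Unique.Propositional using (Unique)
open import Data.Maybe using (Maybe; just; nothing)
open import Data.Product using (_×_; ∃; ∃-syntax; Σ-syntax)
open import Data.Unit using (⊤)
open import Relation.Binary.PropositionalEquality using (_≡_; _≢_)
open import Relation.Nullary using (¬_)
open import Function.Bundles using (_⇔_)

-- A finite ordered set is modelled as a (decidable) partial order _≤_ on Fin n.
-- Subsets S of the carrier give induced suborders (e.g. P ∖ {a} is S v = v ≢ a).
module Order {n : ℕ} (_≤_ : Fin n → Fin n → Set) where

  _<_ : Fin n → Fin n → Set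
  x < y = (x ≤ y) × (x ≢ y)

  UpperCover : Fin n → Fin n → Set
  UpperCover x y = (x < y) × (¬ (∃[ z ] ((x < z) × (z < y))))

  -- v is minimal in the induced suborder on S, among the elements not in `done`
  -- (i.e. minimal in Q ∖ {x₁,…,xᵢ} where Q is the suborder on S)
  MinimalIn : (S : Fin n → Set) → List (Fin n) → Fin n → Set
  MinimalIn S done v = S v × (v ∉ done) × (∀ w → S w → w ∉ done → ¬ (w < v))

  IsLinearExtension : (S : Fin n → Set) → List (Fin n) → Set
  IsLinearExtension S L =
    Unique L × (∀ v → (v ∈ L) ⇔ S v) ×
    (∀ (i j : Fin (length L)) → lookup L i < lookup L j → i F.< j)

  -- one greedy step: prev is the previously chosen element (nothing at the start)
  GreedyStep : (S : Fin n → Set) → List (Fin n) → Maybe (Fin n) → Fin n → Set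
  GreedyStep S done nothing v = MinimalIn S done v
  GreedyStep S done (just u) v =
    MinimalIn S done v × ((∃[ w ] ((u < w) × MinimalIn S done w)) → u < v)

  GreedyFrom : (S : Fin n → Set) → List (Fin n) → Maybe (Fin n) → List (Fin n) → Set
  GreedyFrom S done p [] = ⊤
  GreedyFrom S done p (v ∷ L) = GreedyStep S done p v × GreedyFrom S (done ++ [ v ]) (just v) L

  IsGreedyLinearExtension : (S : Fin n → Set) → List (Fin n) → Set
  IsGreedyLinearExtension S L = IsLinearExtension S L × GreedyFrom S [] nothing L

  PutsBefore : List (Fin n) → Fin n → Fin n → Set
  PutsBefore L x y =
    ∃[ i ] ∃[ j ] ((i F.< j) × (lookup L i ≡ x) × (lookup L j ≡ y))

  GreedyBefore : (S : Fin n → Set) → Fin n → Fin n → List (Fin n) → Set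
  GreedyBefore S x y L = IsGreedyLinearExtension S L × PutsBefore L x y

  -- A is a duplicate-free enumeration of all lists satisfying Q; its length is
  -- then the number of such lists.
  Enumerates : (List (Fin n) → Set) → List (List (Fin n)) → Set
  Enumerates Q A = Unique A × (∀ L → (L ∈ A) ⇔ Q L)

module Submission where

-- We show that deleting a is a bijection from the greedy
-- linear extensions of P onto those of P ∖ {a}; its inverse inserts a right
-- before the first element above a.  Both maps fix the relative order of any
-- x, y ≢ a, so the two sets of extensions putting x before y have the same size.

open import Defs
open import Data.Nat using (ℕ; s≤s; z≤n)
open import Data.Fin using (Fin; _≟_) renaming (zero to fzero; suc to fsuc)
import Data.Fin as F
open import Data.List using (List; []; _∷_; _++_; [_]; length; lookup; map; allFin)
open import Data.List.Properties using (length-map; map-∘; map-id-local)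
open import Data.List.Membership.Propositional using (_∈_; _∉_)
open import Data.List.Membership.Propositional.Properties
  using (∈-lookup; ∈-++⁺ˡ; ∈-++⁺ʳ; ∈-++⁻; ∈-map⁺; ∈-map⁻; ∈-allFin)
open import Data.List.Membership.Propositional.Properties.WithK using (unique∧set⇒bag)
open import Data.List.Relation.Binary.BagAndSetEquality using (∼bag⇒↭)
open import Data.List.Relation.Binary.Permutation.Propositional.Properties using (↭-length)
open import Data.List.Relation.Unary.Any using (here; there; index)
open import Data.List.Relation.Unary.Any.Properties using (lookup-index)
import Data.List.Relation.Unary.All as All
open import Data.List.Relation.Unary.AllPairs using ([]; _∷_)
open import Data.List.Relation.Unary.Unique.Propositional using (Unique)
import Data.List.Relation.Unary.Unique.Propositional.Properties as Unique
open import Data.Maybe using (just; nothing)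
open import Data.Maybe.Properties using (just-injective)
open import Data.Product using (_×_; ∃-syntax; _,_; proj₁; proj₂)
open import Data.Sum using (_⊎_; inj₁; inj₂)
open import Data.Empty using (⊥; ⊥-elim)
open import Data.Unit using (⊤; tt)
open import Function.Bundles using (_⇔_; mk⇔; Equivalence)
open import Relation.Binary.PropositionalEquality
  using (_≡_; _≢_; refl; sym; trans; cong; subst; module ≡-Reasoning)
open import Relation.Binary.Structures using (IsDecPartialOrder; IsDecStrictPartialOrder)
import Relation.Binary.Construct.NonStrictToStrict as NonStrictToStrict
open import Relation.Nullary using (¬_; yes; no)
open import Relation.Nullary.Decidable using (_×-dec_; ¬?)
open import Relation.Unary using (Decidable)

open Equivalence using (to; from)

-- Two duplicate-free lists put in bijection by maps f and g, inverse to each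
-- other on them, have the same length: map f xs is duplicate-free (g undoes f)
-- and has the same members as ys, hence is a permutation of ys.
length-≡-by-inverses : ∀ {A : Set} (f g : A → A) {xs ys : List A} →
  Unique xs → Unique ys →
  (∀ {x} → x ∈ xs → f x ∈ ys) → (∀ {y} → y ∈ ys → g y ∈ xs) →
  (∀ {x} → x ∈ xs → g (f x) ≡ x) → (∀ {y} → y ∈ ys → f (g y) ≡ y) →
  length xs ≡ length ys
length-≡-by-inverses f g {xs} {ys} unique-xs unique-ys f∈ g∈ g∘f f∘g = begin
  length xs         ≡⟨ sym (length-map f xs) ⟩
  length (map f xs) ≡⟨ ↭-length (∼bag⇒↭ (unique∧set⇒bag unique-fxs unique-ys same-members)) ⟩
  length ys         ∎
  where
  open ≡-Reasoning
  g-undoes-f : map g (map f xs) ≡ xs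
  g-undoes-f = trans (sym (map-∘ xs)) (map-id-local (All.tabulate g∘f))
  unique-fxs : Unique (map f xs)
  unique-fxs = Unique.map⁻ (subst Unique (sym g-undoes-f) unique-xs)
  to-ys : ∀ {z} → z ∈ map f xs → z ∈ ys
  to-ys z∈ with ∈-map⁻ f z∈
  ... | x , x∈ , refl = f∈ x∈
  from-ys : ∀ {z} → z ∈ ys → z ∈ map f xs
  from-ys z∈ = subst (_∈ map f xs) (f∘g z∈) (∈-map⁺ f (g∈ z∈))
  same-members : ∀ {z} → (z ∈ map f xs) ⇔ (z ∈ ys)
  same-members = mk⇔ to-ys from-ys

module _ {A : Set} {d : List A} {v w : A} where

  ∉-extend : w ∉ d → w ≢ v → w ∉ d ++ [ v ]
  ∉-extend w∉d w≢v w∈ with ∈-++⁻ d w∈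
  ... | inj₁ w∈d = w∉d w∈d
  ... | inj₂ (here w≡v) = w≢v w≡v

  ∉-extend⁻ : w ∉ d ++ [ v ] → w ∉ d × w ≢ v
  ∉-extend⁻ w∉ = (λ w∈d → w∉ (∈-++⁺ˡ w∈d)) , (λ w≡v → w∉ (∈-++⁺ʳ d (here w≡v)))

  ∈-tail : w ∈ v ∷ d → w ≢ v → w ∈ d
  ∈-tail (here w≡v) w≢v = ⊥-elim (w≢v w≡v)
  ∈-tail (there w∈d) _ = w∈d

Before : ∀ {A : Set} → A → A → List A → Set
Before x y [] = ⊥
Before x y (v ∷ L) = (v ≡ x × y ∈ L) ⊎ Before x y L

-- Greedy sequences for an arbitrary relation _≤_; no order axioms are needed.
module GreedySequences {n : ℕ} (_≤_ : Fin n → Fin n → Set) where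
  open Order _≤_

  Remaining : (Fin n → Set) → List (Fin n) → Fin n → Set
  Remaining S done w = S w × w ∉ done

  SameRemaining : (Fin n → Set) → List (Fin n) → (Fin n → Set) → List (Fin n) → Set
  SameRemaining S₁ d₁ S₂ d₂ = ∀ w → Remaining S₁ d₁ w ⇔ Remaining S₂ d₂ w

  same-remaining-sym : ∀ {S₁ d₁ S₂ d₂} → SameRemaining S₁ d₁ S₂ d₂ → SameRemaining S₂ d₂ S₁ d₁
  same-remaining-sym same w = mk⇔ (from (same w)) (to (same w))

  same-remaining-extend : ∀ {S₁ d₁ S₂ d₂} → SameRemaining S₁ d₁ S₂ d₂ →
    ∀ v → SameRemaining S₁ (d₁ ++ [ v ]) S₂ (d₂ ++ [ v ])
  same-remaining-extend same v w = mk⇔ (move same) (move (same-remaining-sym same))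
    where
    move : ∀ {T₁ e₁ T₂ e₂} → SameRemaining T₁ e₁ T₂ e₂ →
      Remaining T₁ (e₁ ++ [ v ]) w → Remaining T₂ (e₂ ++ [ v ]) w
    move same′ (tw , w∉) =
      let (w∉e₁ , w≢v) = ∉-extend⁻ w∉
          (t′w , w∉e₂) = to (same′ w) (tw , w∉e₁)
      in t′w , ∉-extend w∉e₂ w≢v

  minimal-transport : ∀ {S₁ d₁ S₂ d₂ v} → SameRemaining S₁ d₁ S₂ d₂ →
    MinimalIn S₁ d₁ v → MinimalIn S₂ d₂ v
  minimal-transport {v = v} same (s₁v , v∉d₁ , minimal) =
    let (s₂v , v∉d₂) = to (same v) (s₁v , v∉d₁) in
    s₂v , v∉d₂ , λ w s₂w w∉d₂ → let (s₁w , w∉d₁) = from (same w) (s₂w , w∉d₂) in minimal w s₁w w∉d₁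

  GreedyRule : (Fin n → Set) → List (Fin n) → Fin n → Fin n → Set
  GreedyRule S d u v = (∃[ w ] ((u < w) × MinimalIn S d w)) → u < v

  rule-transfer : ∀ {S₁ d₁ S₂ d₂ u v} →
    (∀ {w} → u < w → MinimalIn S₂ d₂ w → MinimalIn S₁ d₁ w) →
    GreedyRule S₁ d₁ u v → GreedyRule S₂ d₂ u v
  rule-transfer new⇒old rule (w , u<w , w-min) = rule (w , u<w , new⇒old u<w w-min)

  step-minimal : ∀ {S d} p {v} → GreedyStep S d p v → MinimalIn S d v
  step-minimal nothing step = step
  step-minimal (just _) (minimal , _) = minimal

  step-transport : ∀ {S₁ d₁ S₂ d₂} p {v} → SameRemaining S₁ d₁ S₂ d₂ →
    GreedyStep S₁ d₁ p v → GreedyStep S₂ d₂ p v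
  step-transport nothing same minimal = minimal-transport same minimal
  step-transport (just u) same (minimal , rule) =
    minimal-transport same minimal , rule-transfer (λ _ → minimal-transport (same-remaining-sym same)) rule

  greedy-transport : ∀ {S₁ d₁ S₂ d₂} p L → SameRemaining S₁ d₁ S₂ d₂ →
    GreedyFrom S₁ d₁ p L → GreedyFrom S₂ d₂ p L
  greedy-transport p [] _ _ = tt
  greedy-transport p (v ∷ L) same (step , rest) =
    step-transport p same step , greedy-transport (just v) L (same-remaining-extend same v) rest

  greedy-remaining : ∀ {S d} p L {v} → GreedyFrom S d p L → v ∈ L → Remaining S d v
  greedy-remaining p (v ∷ L) (step , _) (here refl) =
    let (sv , v∉d , _) = step-minimal p step in sv , v∉d
  greedy-remaining p (v ∷ L) (_ , rest) (there w∈L) =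
    let (sw , w∉) = greedy-remaining (just v) L rest w∈L in sw , proj₁ (∉-extend⁻ w∉)

  greedy-unique : ∀ {S d} p L → GreedyFrom S d p L → Unique L
  greedy-unique p [] _ = []
  greedy-unique p (v ∷ L) (_ , rest) =
    All.tabulate (λ w∈L v≡w → proj₂ (∉-extend⁻ (proj₂ (greedy-remaining (just v) L rest w∈L))) (sym v≡w))
    ∷ greedy-unique (just v) L rest

  greedy-ordered : ∀ {S d} p L → GreedyFrom S d p L →
    ∀ (i j : Fin (length L)) → lookup L i < lookup L j → i F.< j
  greedy-ordered p (v ∷ L) _ fzero fzero (_ , v≢v) = ⊥-elim (v≢v refl)
  greedy-ordered p (v ∷ L) _ fzero (fsuc j) _ = s≤s z≤n
  greedy-ordered p (v ∷ L) (step , rest) (fsuc i) fzero lt =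
    let (sw , w∉) = greedy-remaining (just v) L rest (∈-lookup i) in
    ⊥-elim (proj₂ (proj₂ (step-minimal p step)) (lookup L i) sw (proj₁ (∉-extend⁻ w∉)) lt)
  greedy-ordered p (v ∷ L) (_ , rest) (fsuc i) (fsuc j) lt = s≤s (greedy-ordered (just v) L rest i j lt)

  greedy-linear-extension : ∀ {S} L → GreedyFrom S [] nothing L → (∀ v → S v → v ∈ L) →
    IsLinearExtension S L
  greedy-linear-extension L greedy exhausts =
    greedy-unique nothing L greedy ,
    (λ v → mk⇔ (λ v∈L → proj₁ (greedy-remaining nothing L greedy v∈L)) (exhausts v)) ,
    greedy-ordered nothing L greedy

  puts-before⇒before : ∀ {x y} L → PutsBefore L x y → Before x y L
  puts-before⇒before (v ∷ L) (fzero , fzero , () , _)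
  puts-before⇒before (v ∷ L) (fzero , fsuc j , _ , v≡x , Lj≡y) = inj₁ (v≡x , subst (_∈ L) Lj≡y (∈-lookup j))
  puts-before⇒before (v ∷ L) (fsuc i , fzero , () , _)
  puts-before⇒before (v ∷ L) (fsuc i , fsuc j , s≤s i<j , Li≡x , Lj≡y) =
    inj₂ (puts-before⇒before L (i , j , i<j , Li≡x , Lj≡y))

  before⇒puts-before : ∀ {x y} L → Before x y L → PutsBefore L x y
  before⇒puts-before (v ∷ L) (inj₁ (v≡x , y∈L)) = fzero , fsuc (index y∈L) , s≤s z≤n , v≡x , sym (lookup-index y∈L)
  before⇒puts-before (v ∷ L) (inj₂ before) =
    let (i , j , i<j , Li≡x , Lj≡y) = before⇒puts-before L before in fsuc i , fsuc j , s≤s i<j , Li≡x , Lj≡y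

module MinimalElements {n : ℕ} {_≤_ : Fin n → Fin n → Set} (dpo : IsDecPartialOrder _≡_ _≤_) where
  open Order _≤_
  open IsDecStrictPartialOrder (NonStrictToStrict.<-isDecStrictPartialOrder _≡_ _≤_ dpo) public
    using (_<?_) renaming (trans to <-trans)

  minimal-among : (R : Fin n → Set) → Decidable R → (xs : List (Fin n)) →
    (∃[ m ] (R m × (∀ w → w ∈ xs → R w → ¬ (w < m)))) ⊎ (∀ w → w ∈ xs → ¬ R w)
  minimal-among R R? [] = inj₂ (λ _ ())
  minimal-among R R? (x ∷ xs) with minimal-among R R? xs | R? x
  ... | inj₂ none | no ¬Rx = inj₂ λ { w (here refl) → ¬Rx ; w (there w∈) → none w w∈ }
  ... | inj₂ none | yes Rx = inj₁ (x , Rx , λ { w (here refl) _ (_ , x≢x) → x≢x refl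
                                                  ; w (there w∈) Rw _ → none w w∈ Rw })
  ... | inj₁ (m , Rm , m-min) | no ¬Rx = inj₁ (m , Rm , λ { w (here refl) Rw _ → ¬Rx Rw
                                                            ; w (there w∈) → m-min w w∈ })
  ... | inj₁ (m , Rm , m-min) | yes Rx with x <? m
  ...   | yes x<m = inj₁ (x , Rx , λ { w (here refl) _ (_ , x≢x) → x≢x refl
                                     ; w (there w∈) Rw w<x → m-min w w∈ Rw (<-trans w<x x<m) })
  ...   | no x≮m = inj₁ (m , Rm , λ { w (here refl) _ → x≮m ; w (there w∈) → m-min w w∈ })

  minimal-witness : (R : Fin n → Set) → Decidable R → ∀ {z} → R z →
    ∃[ m ] (R m × (∀ w → R w → ¬ (w < m)))
  minimal-witness R R? {z} Rz with minimal-among R R? (allFin n)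
  ... | inj₁ (m , Rm , m-min) = m , Rm , λ w → m-min w (∈-allFin w)
  ... | inj₂ none = ⊥-elim (none z (∈-allFin z) Rz)

module RemovingMinimal {n : ℕ} {_≤_ : Fin n → Fin n → Set} (dpo : IsDecPartialOrder _≡_ _≤_)
  (a : Fin n)
  (a-minimal : ∀ z → ¬ (Order._<_ _≤_ z a))
  (a-not-maximal : ∃[ z ] Order._<_ _≤_ a z)
  (covers-minimal : ∀ u → Order.UpperCover _≤_ a u → Order.MinimalIn _≤_ (λ v → v ≢ a) [] u)
  where
  open Order _≤_
  open GreedySequences _≤_
  open MinimalElements dpo
  open IsDecPartialOrder dpo using () renaming (refl to ≤-refl)
  open import Data.List.Membership.DecPropositional (_≟_ {n}) using (_∈?_)

  P P∖a : Fin n → Set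
  P _ = ⊤
  P∖a v = v ≢ a

  -- d contains no element of the up-set of a: the placed elements at any stage
  -- of a greedy extension of P before a itself is placed.
  UpsetFree : List (Fin n) → Set
  UpsetFree d = ∀ z → a ≤ z → z ∉ d

  upset-free-a∉ : ∀ {d} → UpsetFree d → a ∉ d
  upset-free-a∉ free = free a ≤-refl

  not-above : ∀ {v} → v ≢ a → ¬ (a < v) → ¬ (a ≤ v)
  not-above v≢a a≮v a≤v = a≮v (a≤v , λ a≡v → v≢a (sym a≡v))

  upset-free-extend : ∀ {d v} → UpsetFree d → v ≢ a → ¬ (a < v) → UpsetFree (d ++ [ v ])
  upset-free-extend free v≢a a≮v z a≤z = ∉-extend (free z a≤z) λ { refl → not-above v≢a a≮v a≤z }

  placed-not-above : ∀ {d} p {v} → UpsetFree d → GreedyStep P d p v → ¬ (a < v)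
  placed-not-above p free step = proj₂ (proj₂ (step-minimal p step)) a tt (upset-free-a∉ free)

  remaining-cover : ∀ {d w} → UpsetFree d → a < w → MinimalIn P∖a d w → UpperCover a w
  remaining-cover free a<w (_ , _ , minimal) =
    a<w , λ (z , a<z , z<w) → minimal z (λ z≡a → proj₂ a<z (sym z≡a)) (free z (proj₁ a<z)) z<w

  below-cover : ∀ {w x} → UpperCover a w → x ≢ a → ¬ (x < w)
  below-cover cover x≢a = proj₂ (proj₂ (covers-minimal _ cover)) _ x≢a (λ ())

  -- Minimality in P and in P ∖ {a} agree for elements other than a, except that
  -- in P an unplaced a also blocks the elements above it.
  minimal-P→P∖a : ∀ {d v} → v ≢ a → MinimalIn P d v → MinimalIn P∖a d v
  minimal-P→P∖a v≢a (_ , v∉d , minimal) = v≢a , v∉d , λ w _ → minimal w tt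

  minimal-P∖a→P : ∀ {d v} → ¬ (a < v) → MinimalIn P∖a d v → MinimalIn P d v
  minimal-P∖a→P {d} {v} a≮v (_ , v∉d , minimal) = tt , v∉d , below-v
    where
    below-v : ∀ w → ⊤ → w ∉ d → ¬ (w < v)
    below-v w _ w∉d w<v with w ≟ a
    ... | yes refl = a≮v w<v
    ... | no w≢a = minimal w w≢a w∉d w<v

  -- Greedy candidates above some x are the same in P and in P ∖ {a}: a is
  -- never above x, and a candidate above a would be an upper cover of a.
  candidate-P→P∖a : ∀ {d x w} → x < w → MinimalIn P d w → MinimalIn P∖a d w
  candidate-P→P∖a {x = x} x<w = minimal-P→P∖a λ { refl → a-minimal x x<w }

  candidate-P∖a→P : ∀ {d x w} → x ≢ a → UpsetFree d → x < w → MinimalIn P∖a d w → MinimalIn P d w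
  candidate-P∖a→P {w = w} x≢a free x<w w-min with a <? w
  ... | yes a<w = ⊥-elim (below-cover (remaining-cover free a<w w-min) x≢a x<w)
  ... | no a≮w = minimal-P∖a→P a≮w w-min

  remaining-skip-a : ∀ d → SameRemaining P (d ++ [ a ]) P∖a d
  remaining-skip-a d w = mk⇔
    (λ (_ , w∉) → let (w∉d , w≢a) = ∉-extend⁻ w∉ in w≢a , w∉d)
    (λ (w≢a , w∉d) → tt , ∉-extend w∉d w≢a)

  open-above? : ∀ d → Decidable (λ w → (a < w) × (w ∉ d))
  open-above? d w = (a <? w) ×-dec ¬? (w ∈? d)

  -- Once d and then a have been placed, some element above a is a greedy
  -- candidate: a minimal unplaced element above a is an upper cover of a, so by
  -- hypothesis nothing but a lies below it.
  cover-candidate : ∀ {d} → UpsetFree d → ∃[ w ] ((a < w) × MinimalIn P (d ++ [ a ]) w)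
  cover-candidate {d} free
    with minimal-witness _ (open-above? d) (proj₂ a-not-maximal , free _ (proj₁ (proj₂ a-not-maximal)))
  ... | m , (a<m , m∉d) , m-min = m , a<m , tt , ∉-extend m∉d (λ m≡a → proj₂ a<m (sym m≡a)) ,
    λ w _ w∉ → below-cover cover (proj₂ (∉-extend⁻ w∉))
    where
    cover : UpperCover a m
    cover = a<m , λ (z , a<z , z<m) → m-min z (a<z , free z (proj₁ a<z)) z<m

  prev-not-a : ∀ {x} → just x ≢ just a → x ≢ a
  prev-not-a p≢a x≡a = p≢a (cong just x≡a)

  step-kept : ∀ {d} p {v} → UpsetFree d → p ≢ just a → v ≢ a →
    GreedyStep P d p v → GreedyStep P∖a d p v
  step-kept nothing _ _ v≢a v-min = minimal-P→P∖a v≢a v-min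
  step-kept (just x) free p≢a v≢a (v-min , rule) =
    minimal-P→P∖a v≢a v-min , rule-transfer (candidate-P∖a→P (prev-not-a p≢a) free) rule

  -- Deleting a: its successor u takes its place, and the greedy rule for u is
  -- vacuous, since a candidate above x would have forced x < a.
  step-replacing-a : ∀ {d} p {u} → UpsetFree d → p ≢ just a →
    GreedyStep P d p a → GreedyStep P (d ++ [ a ]) (just a) u → GreedyStep P∖a d p u
  step-replacing-a {d} nothing _ _ _ u-step = minimal-transport (remaining-skip-a d) (step-minimal (just a) u-step)
  step-replacing-a {d} (just x) free p≢a (_ , rule) u-step =
    minimal-transport (remaining-skip-a d) (step-minimal (just a) u-step) ,
    λ (w , x<w , w-min) → ⊥-elim (a-minimal x (rule (w , x<w , candidate-P∖a→P (prev-not-a p≢a) free x<w w-min)))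

  step-unaffected : ∀ {d} p {v} → ¬ (a < v) → GreedyStep P∖a d p v → GreedyStep P d p v
  step-unaffected nothing a≮v v-min = minimal-P∖a→P a≮v v-min
  step-unaffected (just x) a≮v (v-min , rule) = minimal-P∖a→P a≮v v-min , rule-transfer candidate-P→P∖a rule

  -- Inserting a before the first element v above a: a is minimal, and the
  -- greedy rule is vacuous, since v is an upper cover of a and so not above x.
  step-inserted-a : ∀ {d} p {v} → UpsetFree d → p ≢ just a → a < v →
    GreedyStep P∖a d p v → GreedyStep P d p a
  step-inserted-a nothing free _ _ _ = tt , upset-free-a∉ free , λ w _ _ → a-minimal w
  step-inserted-a (just x) free p≢a a<v (v-min , rule) =
    (tt , upset-free-a∉ free , λ w _ _ → a-minimal w) ,
    λ (w , x<w , w-min) → ⊥-elim (below-cover (remaining-cover free a<v v-min) (prev-not-a p≢a)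
                                      (rule (w , x<w , candidate-P→P∖a x<w w-min)))

  step-after-a : ∀ {d} p {v} → a < v → GreedyStep P∖a d p v → GreedyStep P (d ++ [ a ]) (just a) v
  step-after-a {d} p a<v v-step =
    minimal-transport (same-remaining-sym (remaining-skip-a d)) (step-minimal p v-step) , λ _ → a<v

  delete-a : List (Fin n) → List (Fin n)
  delete-a [] = []
  delete-a (v ∷ L) with v ≟ a
  ... | yes _ = L
  ... | no _ = v ∷ delete-a L

  insert-a : List (Fin n) → List (Fin n)
  insert-a [] = []
  insert-a (v ∷ L) with a <? v
  ... | yes _ = a ∷ v ∷ L
  ... | no _ = v ∷ insert-a L

  delete-greedy : ∀ d p L → UpsetFree d → p ≢ just a →
    GreedyFrom P d p L → GreedyFrom P∖a d p (delete-a L)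
  delete-greedy d p [] _ _ _ = tt
  delete-greedy d p (v ∷ L) free p≢a (step , rest) with v ≟ a
  delete-greedy d p (v ∷ []) free p≢a (step , rest) | yes refl = tt
  delete-greedy d p (v ∷ u ∷ L) free p≢a (step , u-step , rest) | yes refl =
    step-replacing-a p free p≢a step u-step ,
    greedy-transport (just u) L (same-remaining-extend (remaining-skip-a d) u) rest
  ... | no v≢a =
    step-kept p free p≢a v≢a step ,
    delete-greedy (d ++ [ v ]) (just v) L (upset-free-extend free v≢a a≮v) (λ e → v≢a (just-injective e)) rest
    where
    a≮v : ¬ (a < v)
    a≮v = placed-not-above p free step

  insert-greedy : ∀ d p L → UpsetFree d → p ≢ just a →
    GreedyFrom P∖a d p L → GreedyFrom P d p (insert-a L)
  insert-greedy d p [] _ _ _ = tt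
  insert-greedy d p (v ∷ L) free p≢a (step , rest) with a <? v
  ... | yes a<v =
    step-inserted-a p free p≢a a<v step , step-after-a p a<v step ,
    greedy-transport (just v) L (same-remaining-extend (same-remaining-sym (remaining-skip-a d)) v) rest
  ... | no a≮v =
    step-unaffected p a≮v step ,
    insert-greedy (d ++ [ v ]) (just v) L (upset-free-extend free v≢a a≮v) (λ e → v≢a (just-injective e)) rest
    where
    v≢a : v ≢ a
    v≢a = proj₁ (step-minimal p step)

  delete-a-a : ∀ L → delete-a (a ∷ L) ≡ L
  delete-a-a L with a ≟ a
  ... | yes _ = refl
  ... | no a≢a = ⊥-elim (a≢a refl)

  delete-a-other : ∀ {v} L → v ≢ a → delete-a (v ∷ L) ≡ v ∷ delete-a L
  delete-a-other {v} L v≢a with v ≟ a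
  ... | yes v≡a = ⊥-elim (v≢a v≡a)
  ... | no _ = refl

  insert-a-above : ∀ {u} L → a < u → insert-a (u ∷ L) ≡ a ∷ u ∷ L
  insert-a-above {u} L a<u with a <? u
  ... | yes _ = refl
  ... | no a≮u = ⊥-elim (a≮u a<u)

  insert-a-not-above : ∀ {v} L → ¬ (a < v) → insert-a (v ∷ L) ≡ v ∷ insert-a L
  insert-a-not-above {v} L a≮v with a <? v
  ... | yes a<v = ⊥-elim (a≮v a<v)
  ... | no _ = refl

  delete-a-keeps : ∀ {w} L → w ≢ a → w ∈ L → w ∈ delete-a L
  delete-a-keeps (v ∷ L) w≢a w∈ with v ≟ a
  ... | yes refl = ∈-tail w∈ w≢a
  delete-a-keeps (v ∷ L) w≢a (here w≡v) | no _ = here w≡v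
  delete-a-keeps (v ∷ L) w≢a (there w∈L) | no _ = there (delete-a-keeps L w≢a w∈L)

  insert-a-keeps : ∀ {w} L → w ∈ L → w ∈ insert-a L
  insert-a-keeps (v ∷ L) w∈ with a <? v
  ... | yes _ = there w∈
  insert-a-keeps (v ∷ L) (here w≡v) | no _ = here w≡v
  insert-a-keeps (v ∷ L) (there w∈L) | no _ = there (insert-a-keeps L w∈L)

  insert-a-adds-a : ∀ {z} L → z ∈ L → a < z → a ∈ insert-a L
  insert-a-adds-a (v ∷ L) z∈ a<z with a <? v
  ... | yes _ = here refl
  insert-a-adds-a (v ∷ L) (here refl) a<z | no a≮v = ⊥-elim (a≮v a<z)
  insert-a-adds-a (v ∷ L) (there z∈L) a<z | no _ = there (insert-a-adds-a L z∈L a<z)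

  greedy-upset-free : ∀ {d} p L → GreedyFrom P d p L → (∀ z → a ≤ z → z ∈ L) → UpsetFree d
  greedy-upset-free p L greedy upset z a≤z = proj₂ (greedy-remaining p L greedy (upset z a≤z))

  -- The element placed right after a lies above a, so insertion puts a back.
  insert-after-a : ∀ {d} L → UpsetFree d → (∃[ z ] ((a < z) × (z ∈ L))) →
    GreedyFrom P (d ++ [ a ]) (just a) L → insert-a L ≡ a ∷ L
  insert-after-a [] _ (_ , _ , ()) _
  insert-after-a (u ∷ L) free _ ((_ , rule) , _) = insert-a-above L (rule (cover-candidate free))

  -- Deleting a from a greedy extension of P and inserting it again changes
  -- nothing: up to a no element above a occurs, and a is followed by one.
  insert-delete : ∀ d p L → GreedyFrom P d p L → (∀ z → a ≤ z → z ∈ L) →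
    insert-a (delete-a L) ≡ L
  insert-delete d p [] _ upset with upset a ≤-refl
  ... | ()
  insert-delete d p (v ∷ L) greedy@(step , rest) upset with v ≟ a
  ... | yes refl = insert-after-a L (greedy-upset-free p (a ∷ L) greedy upset)
    (z , a<z , ∈-tail (upset z (proj₁ a<z)) (λ z≡a → proj₂ a<z (sym z≡a))) rest
    where
    z : Fin n
    z = proj₁ a-not-maximal
    a<z : a < z
    a<z = proj₂ a-not-maximal
  ... | no v≢a = begin
    insert-a (v ∷ delete-a L) ≡⟨ insert-a-not-above (delete-a L) a≮v ⟩
    v ∷ insert-a (delete-a L) ≡⟨ cong (v ∷_) (insert-delete (d ++ [ v ]) (just v) L rest upset-in-tail) ⟩
    v ∷ L                     ∎
    where
    open ≡-Reasoning
    a≮v : ¬ (a < v)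
    a≮v = placed-not-above p (greedy-upset-free p (v ∷ L) greedy upset) step
    upset-in-tail : ∀ z → a ≤ z → z ∈ L
    upset-in-tail z a≤z = ∈-tail (upset z a≤z) λ { refl → not-above v≢a a≮v a≤z }

  delete-insert : ∀ L → a ∉ L → delete-a (insert-a L) ≡ L
  delete-insert [] _ = refl
  delete-insert (v ∷ L) a∉ with a <? v
  ... | yes _ = delete-a-a (v ∷ L)
  ... | no _ = trans (delete-a-other (insert-a L) (λ v≡a → a∉ (here (sym v≡a))))
                     (cong (v ∷_) (delete-insert L (λ a∈L → a∉ (there a∈L))))

  before-delete : ∀ {x y} → x ≢ a → y ≢ a → ∀ L → Before x y L → Before x y (delete-a L)
  before-delete x≢a y≢a (v ∷ L) before with v ≟ a | before
  ... | yes refl | inj₁ (a≡x , _) = ⊥-elim (x≢a (sym a≡x))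
  ... | yes refl | inj₂ before′ = before′
  ... | no _ | inj₁ (v≡x , y∈L) = inj₁ (v≡x , delete-a-keeps L y≢a y∈L)
  ... | no _ | inj₂ before′ = inj₂ (before-delete x≢a y≢a L before′)

  before-insert : ∀ {x y} L → Before x y L → Before x y (insert-a L)
  before-insert (v ∷ L) before with a <? v | before
  ... | yes _ | _ = inj₂ before
  ... | no _ | inj₁ (v≡x , y∈L) = inj₁ (v≡x , insert-a-keeps L y∈L)
  ... | no _ | inj₂ before′ = inj₂ (before-insert L before′)

  delete-extension : ∀ L → IsGreedyLinearExtension P L → IsGreedyLinearExtension P∖a (delete-a L)
  delete-extension L ((_ , members , _) , greedy) = greedy-linear-extension (delete-a L) greedy′ exhausts , greedy′
    where
    greedy′ : GreedyFrom P∖a [] nothing (delete-a L)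
    greedy′ = delete-greedy [] nothing L (λ _ _ ()) (λ ()) greedy
    exhausts : ∀ v → v ≢ a → v ∈ delete-a L
    exhausts v v≢a = delete-a-keeps L v≢a (from (members v) tt)

  insert-extension : ∀ L → IsGreedyLinearExtension P∖a L → IsGreedyLinearExtension P (insert-a L)
  insert-extension L ((_ , members , _) , greedy) = greedy-linear-extension (insert-a L) greedy′ exhausts , greedy′
    where
    greedy′ : GreedyFrom P [] nothing (insert-a L)
    greedy′ = insert-greedy [] nothing L (λ _ _ ()) (λ ()) greedy
    exhausts : ∀ v → ⊤ → v ∈ insert-a L
    exhausts v _ with v ≟ a
    ... | no v≢a = insert-a-keeps L (from (members v) v≢a)
    ... | yes refl =
      let (z , a<z) = a-not-maximal in
      insert-a-adds-a L (from (members z) (λ z≡a → proj₂ a<z (sym z≡a))) a<z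

  insert-delete-extension : ∀ L → IsGreedyLinearExtension P L → insert-a (delete-a L) ≡ L
  insert-delete-extension L ((_ , members , _) , greedy) =
    insert-delete [] nothing L greedy (λ z _ → from (members z) tt)

  delete-insert-extension : ∀ L → IsGreedyLinearExtension P∖a L → delete-a (insert-a L) ≡ L
  delete-insert-extension L ((_ , members , _) , _) = delete-insert L (λ a∈L → to (members a) a∈L refl)

-- Deletion of a is a bijection between the two sets of greedy extensions with
-- x before y.
mainTheorem8 : (n : ℕ) (_≤_ : Fin n → Fin n → Set) →
    IsDecPartialOrder _≡_ _≤_ →
    (a : Fin n) →
    (∀ z → ¬ (Order._<_ _≤_ z a)) →
    (∃[ z ] Order._<_ _≤_ a z) →
    (∀ u → Order.UpperCover _≤_ a u → Order.MinimalIn _≤_ (λ v → v ≢ a) [] u) →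
    (x y : Fin n) → x ≢ a → y ≢ a → ¬ (x ≤ y) → ¬ (y ≤ x) →
    (A B : List (List (Fin n))) →
    Order.Enumerates _≤_ (Order.GreedyBefore _≤_ (λ _ → ⊤) x y) A →
    Order.Enumerates _≤_ (Order.GreedyBefore _≤_ (λ v → v ≢ a) x y) B →
    length A ≡ length B
mainTheorem8 n _≤_ dpo a a-minimal a-not-maximal covers-minimal x y x≢a y≢a _ _ A B
             (unique-A , A-enumerates) (unique-B , B-enumerates) =
  length-≡-by-inverses delete-a insert-a unique-A unique-B
    (λ {L} L∈A → from (B-enumerates _) (delete-before L (to (A-enumerates L) L∈A)))
    (λ {L} L∈B → from (A-enumerates _) (insert-before L (to (B-enumerates L) L∈B)))
    (λ {L} L∈A → insert-delete-extension L (proj₁ (to (A-enumerates L) L∈A)))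
    (λ {L} L∈B → delete-insert-extension L (proj₁ (to (B-enumerates L) L∈B)))
  where
  open Order _≤_ using (GreedyBefore)
  open GreedySequences _≤_ using (puts-before⇒before; before⇒puts-before)
  open RemovingMinimal dpo a a-minimal a-not-maximal covers-minimal

  delete-before : ∀ L → GreedyBefore P x y L → GreedyBefore P∖a x y (delete-a L)
  delete-before L (extension , x-before-y) =
    delete-extension L extension ,
    before⇒puts-before (delete-a L) (before-delete x≢a y≢a L (puts-before⇒before L x-before-y))

  insert-before : ∀ L → GreedyBefore P∖a x y L → GreedyBefore P x y (insert-a L)
  insert-before L (extension , x-before-y) =
    insert-extension L extension ,
    before⇒puts-before (insert-a L) (before-insert L (puts-before⇒before L x-before-y))
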